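{- For any time warp $f$, $n\in\omega\setminus\{0\}$ and $m\in\omega$: $f^{r}(n)=m\iff f(m)\le n<f(m+1)$; $f^{r}(n)=\omega\iff f(\omega)\le n$; $f^{r}(\omega)=m\iff f(m+1)=\omega$ and $f^{r}(k)=m$ for some $k\in\omega$; $f^{r}(\omega)=\omega\iff f(\omega)<\omega$ or ($f(\omega)=\omega$ and $f(k)<\omega$ for all $k\in\omega$).
   Context: Let $\overline{\omega}=\omega\cup\{\omega\}$ with its natural order. A time warp is a function $f:\overline{\omega}\to\overline{\omega}$ preserving all suprema; equivalently, a monotone function with $f(0)=0$ and $f(\omega)=\bigvee\{f(n)\mid n\in\omega\}$. The set of time warps is ordered pointwise; $\mathrm{id}$ is the identity; the left residual $\backslash$ is characterized by $g\le f\backslash h\iff f\circ g\le h$ for all time warps. Define $f^{r}:=f\backslash\mathrm{id}$. -}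

module Defs where

open import Data.Nat as ℕ using (ℕ)
open import Data.Empty using (⊥-elim)
open import Data.Nat.Properties using (<-irrefl)
open import Data.Product using (_×_)
open import Relation.Binary.PropositionalEquality using (_≡_)

data ω̄ : Set where
  fin : ℕ → ω̄
  ω   : ω̄

data _≤ω_ : ω̄ → ω̄ → Set where
  fin≤fin : ∀ {m n} → m ℕ.≤ n → fin m ≤ω fin n
  ≤ω-top  : ∀ {x} → x ≤ω ω

data _<ω_ : ω̄ → ω̄ → Set where
  fin<fin : ∀ {m n} → m ℕ.< n → fin m <ω fin n
  fin<ω   : ∀ {m} → fin m <ω ω

record TimeWarp : Set where
  field
    fun      : ω̄ → ω̄
    mono     : ∀ {x y} → x ≤ω y → fun x ≤ω fun y
    zero-pres : fun (fin 0) ≡ fin 0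
    sup-ub   : ∀ n → fun (fin n) ≤ω fun ω
    sup-least : ∀ x → (∀ n → fun (fin n) ≤ω x) → fun ω ≤ω x
open TimeWarp public

_≤TW_ : TimeWarp → TimeWarp → Set
f ≤TW g = ∀ x → fun f x ≤ω fun g x

_∘_≤TW_ : TimeWarp → TimeWarp → TimeWarp → Set
f ∘ g ≤TW h = ∀ x → fun f (fun g (x)) ≤ω fun h x

IsLeftResidual : TimeWarp → TimeWarp → TimeWarp → Set
IsLeftResidual f h r = ∀ (g : TimeWarp) → (g ≤TW r → f ∘ g ≤TW h) × (f ∘ g ≤TW h → g ≤TW r)

idTW : TimeWarp
idTW = record
  { fun = λ x → x
  ; mono = λ p → p
  ; zero-pres = _≡_.refl
  ; sup-ub = λ n → ≤ω-top
  ; sup-least = λ x p → helper x p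
  }
  where
  helper : ∀ x → (∀ n → fin n ≤ω x) → ω ≤ω x
  helper ω p = ≤ω-top
  helper (fin m) p with p (ℕ.suc m)
  ... | fin≤fin q = ⊥-elim (<-irrefl _≡_.refl q)

-- For n ≠ 0 the time warp that is 0 below n and y from n on lies below r = f \ id
-- exactly when f y ≤ n, so y ≤ r n ⇔ f y ≤ n: r n is the largest y with f y ≤ n,
-- which gives the first two equivalences. Since r ω is the supremum of the r k and
-- r 0 = 0, it follows that r ω ≤ m ⇔ f (m + 1) = ω, from which the last two follow.
module Submission where

open import Defs
open import Data.Empty using (⊥-elim)
open import Data.Nat as ℕ using (ℕ; zero; suc)
import Data.Nat.Properties as ℕ
open import Data.Product using (_×_; ∃; _,_; proj₁; proj₂)
open import Data.Product.Function.NonDependent.Propositional using (_×-⇔_)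
open import Data.Sum using (_⊎_; inj₁; inj₂)
open import Function.Bundles using (_⇔_; mk⇔; module Equivalence)
open import Function.Properties.Equivalence using () renaming (sym to ⇔-sym; trans to ⇔-trans)
open import Function.Related.TypeIsomorphisms using (¬-cong-⇔)
open import Relation.Binary.PropositionalEquality using (_≡_; _≢_; refl; cong; sym; subst)
open import Relation.Nullary using (¬_; yes; no)

open Equivalence using (to; from)

private
  variable
    m n : ℕ
    x y z : ω̄

≤ω-refl : x ≤ω x
≤ω-refl {fin n} = fin≤fin ℕ.≤-refl
≤ω-refl {ω}     = ≤ω-top

≤ω-reflexive : x ≡ y → x ≤ω y
≤ω-reflexive refl = ≤ω-refl

≤ω-trans : x ≤ω y → y ≤ω z → x ≤ω z
≤ω-trans (fin≤fin p) (fin≤fin q) = fin≤fin (ℕ.≤-trans p q)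
≤ω-trans _           ≤ω-top      = ≤ω-top

≤ω-antisym : x ≤ω y → y ≤ω x → x ≡ y
≤ω-antisym (fin≤fin p) (fin≤fin q) = cong fin (ℕ.≤-antisym p q)
≤ω-antisym ≤ω-top      ≤ω-top      = refl

≤ω-<ω-trans : x ≤ω y → y <ω z → x <ω z
≤ω-<ω-trans (fin≤fin p) (fin<fin q) = fin<fin (ℕ.≤-<-trans p q)
≤ω-<ω-trans (fin≤fin _) fin<ω       = fin<ω

z≤ω : fin 0 ≤ω x
z≤ω {fin n} = fin≤fin ℕ.z≤n
z≤ω {ω}     = ≤ω-top

ω≰fin : ¬ ω ≤ω fin n
ω≰fin ()

fin-suc≰fin : ¬ fin (suc n) ≤ω fin n
fin-suc≰fin (fin≤fin p) = ℕ.1+n≰n p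

≰fin-suc⇒≤ : ¬ fin (suc m) ≤ω x → x ≤ω fin m
≰fin-suc⇒≤ {x = fin a} h = fin≤fin (ℕ.≤-pred (ℕ.≰⇒> (λ p → h (fin≤fin p))))
≰fin-suc⇒≤ {x = ω}     h = ⊥-elim (h ≤ω-top)

fin<ω⇔≰ : (fin n <ω x) ⇔ (¬ x ≤ω fin n)
fin<ω⇔≰ = mk⇔ <⇒≰ ≰⇒<
  where
  <⇒≰ : fin n <ω x → ¬ x ≤ω fin n
  <⇒≰ (fin<fin p) (fin≤fin q) = ℕ.<⇒≱ p q
  ≰⇒< : ¬ x ≤ω fin n → fin n <ω x
  ≰⇒< {x = fin a} h = fin<fin (ℕ.≰⇒> (λ p → h (fin≤fin p)))
  ≰⇒< {x = ω}     h = fin<ω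

<ω-ω⇔≢ω : (x <ω ω) ⇔ (x ≢ ω)
<ω-ω⇔≢ω = mk⇔ (λ { fin<ω () }) ≢ω⇒<ω
  where
  ≢ω⇒<ω : x ≢ ω → x <ω ω
  ≢ω⇒<ω {fin _} _ = fin<ω
  ≢ω⇒<ω {ω}     h = ⊥-elim (h refl)

≡fin⇔ : (x ≡ fin m) ⇔ (fin m ≤ω x × ¬ fin (suc m) ≤ω x)
≡fin⇔ = mk⇔ (λ { refl → ≤ω-refl , fin-suc≰fin })
            (λ (lo , ¬hi) → ≤ω-antisym (≰fin-suc⇒≤ ¬hi) lo)

≡ω⇔ω≤ : (x ≡ ω) ⇔ (ω ≤ω x)
≡ω⇔ω≤ = mk⇔ (λ { refl → ≤ω-top }) (λ { ≤ω-top → refl })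

≡ω⇔unbounded : (x ≡ ω) ⇔ (∀ n → ¬ x ≤ω fin n)
≡ω⇔unbounded = mk⇔ (λ { refl _ () }) unbounded⇒≡ω
  where
  unbounded⇒≡ω : (∀ n → ¬ x ≤ω fin n) → x ≡ ω
  unbounded⇒≡ω {fin a} h = ⊥-elim (h a ≤ω-refl)
  unbounded⇒≡ω {ω}     _ = refl

module _ (f : TimeWarp) where

  all-fin<ω⇔all-suc≢ω : (∀ k → fun f (fin k) <ω ω) ⇔ (∀ m → fun f (fin (suc m)) ≢ ω)
  all-fin<ω⇔all-suc≢ω = mk⇔
    (λ h m → to <ω-ω⇔≢ω (h (suc m)))
    (λ { h zero    → subst (_<ω ω) (sym (zero-pres f)) fin<ω
       ; h (suc m) → from <ω-ω⇔≢ω (h m) })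

  all-fin<ω⇔ : (∀ k → fun f (fin k) <ω ω) ⇔
                 (fun f ω <ω ω ⊎ (fun f ω ≡ ω × (∀ k → fun f (fin k) <ω ω)))
  all-fin<ω⇔ = mk⇔ split (λ { (inj₁ fω<ω) k → ≤ω-<ω-trans (sup-ub f k) fω<ω
                               ; (inj₂ (_ , h)) → h })
    where
    split : (∀ k → fun f (fin k) <ω ω) →
            fun f ω <ω ω ⊎ (fun f ω ≡ ω × (∀ k → fun f (fin k) <ω ω))
    split h with fun f ω
    ... | fin _ = inj₁ fin<ω
    ... | ω     = inj₂ (refl , h)

step : ℕ → ω̄ → ω̄ → ω̄
step n y (fin k) with k ℕ.<? n
... | yes _ = fin 0
... | no  _ = y
step n y ω = y

step-at : ∀ n y → step n y (fin n) ≡ y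
step-at n y with n ℕ.<? n
... | yes n<n = ⊥-elim (ℕ.<-irrefl refl n<n)
... | no  _   = refl

step≤ : ∀ n y x → step n y x ≤ω y
step≤ n y (fin k) with k ℕ.<? n
... | yes _ = z≤ω
... | no  _ = ≤ω-refl
step≤ n y ω = ≤ω-refl

step-mono : ∀ n y {x z} → x ≤ω z → step n y x ≤ω step n y z
step-mono n y {fin k} {fin l} (fin≤fin k≤l) with k ℕ.<? n | l ℕ.<? n
... | yes _   | _       = z≤ω
... | no  _   | no  _   = ≤ω-refl
... | no  k≮n | yes l<n = ⊥-elim (k≮n (ℕ.≤-<-trans k≤l l<n))
step-mono n y {x} ≤ω-top = step≤ n y x

step-zero : n ≢ 0 → ∀ y → step n y (fin 0) ≡ fin 0
step-zero {n} n≢0 y with 0 ℕ.<? n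
... | yes _   = refl
... | no  0≮n = ⊥-elim (0≮n (ℕ.n≢0⇒n>0 n≢0))

threshold : (n : ℕ) → n ≢ 0 → ω̄ → TimeWarp
threshold n n≢0 y = record
  { fun       = step n y
  ; mono      = step-mono n y
  ; zero-pres = step-zero n≢0 y
  ; sup-ub    = λ k → step≤ n y (fin k)
  ; sup-least = λ x h → subst (_≤ω x) (step-at n y) (h n)
  }

∘-step≤id : (f : TimeWarp) → fun f y ≤ω fin n → ∀ x → fun f (step n y x) ≤ω x
∘-step≤id {n = n} f fy≤n (fin k) with k ℕ.<? n
... | yes _   = subst (_≤ω fin k) (sym (zero-pres f)) z≤ω
... | no  k≮n = ≤ω-trans fy≤n (fin≤fin (ℕ.≮⇒≥ k≮n))
∘-step≤id f fy≤n ω = ≤ω-top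

module Residual (f r : TimeWarp) (res : IsLeftResidual f idTW r) where

  counit : ∀ x → fun f (fun r x) ≤ω x
  counit = proj₁ (res r) (λ _ → ≤ω-refl)

  galois : n ≢ 0 → (y ≤ω fun r (fin n)) ⇔ (fun f y ≤ω fin n)
  galois {n} {y} n≢0 = mk⇔
    (λ y≤rn → ≤ω-trans (mono f y≤rn) (counit (fin n)))
    (λ fy≤n → subst (_≤ω fun r (fin n)) (step-at n y)
                (proj₂ (res (threshold n n≢0 y)) (∘-step≤id f fy≤n) (fin n)))

  r-ω≤fin⇔ : (fun r ω ≤ω fin m) ⇔ (fun f (fin (suc m)) ≡ ω)
  r-ω≤fin⇔ {m} = mk⇔ f-suc≡ω (λ f-suc≡ω → sup-least r (fin m) (r-fin≤ f-suc≡ω))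
    where
    f-suc≡ω : fun r ω ≤ω fin m → fun f (fin (suc m)) ≡ ω
    f-suc≡ω rω≤m = from ≡ω⇔unbounded λ k fsm≤k →
      fin-suc≰fin (≤ω-trans (from (galois {suc k} (λ ()))
                                   (≤ω-trans fsm≤k (fin≤fin (ℕ.n≤1+n k))))
                  (≤ω-trans (mono r ≤ω-top) rω≤m))

    r-fin≤ : fun f (fin (suc m)) ≡ ω → ∀ k → fun r (fin k) ≤ω fin m
    r-fin≤ _      zero    = ≤ω-trans (≤ω-reflexive (zero-pres r)) z≤ω
    r-fin≤ f-sm≡ω (suc k) = ≰fin-suc⇒≤ λ sm≤rk →
      ω≰fin (≤ω-trans (≤ω-reflexive (sym f-sm≡ω)) (to (galois (λ ())) sm≤rk))

  fin≤r-ω⇒ : fin m ≤ω fun r ω → ∃ λ k → fin m ≤ω fun r (fin k)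
  fin≤r-ω⇒ {zero}  _    = 0 , z≤ω
  fin≤r-ω⇒ {suc m} m≤rω with fun f (fin (suc m)) in e
  ... | fin j = suc j , from (galois (λ ())) (≤ω-trans (≤ω-reflexive e) (fin≤fin (ℕ.n≤1+n j)))
  ... | ω     = ⊥-elim (fin-suc≰fin (≤ω-trans m≤rω (from r-ω≤fin⇔ e)))

  r-fin≡fin⇔ : n ≢ 0 →
    (fun r (fin n) ≡ fin m) ⇔ ((fun f (fin m) ≤ω fin n) × (fin n <ω fun f (fin (suc m))))
  r-fin≡fin⇔ n≢0 = ⇔-trans ≡fin⇔
    (galois n≢0 ×-⇔ ⇔-trans (¬-cong-⇔ (galois n≢0)) (⇔-sym fin<ω⇔≰))

  r-fin≡ω⇔ : n ≢ 0 → (fun r (fin n) ≡ ω) ⇔ (fun f ω ≤ω fin n)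
  r-fin≡ω⇔ n≢0 = ⇔-trans ≡ω⇔ω≤ (galois n≢0)

  r-ω≡fin⇔ : (fun r ω ≡ fin m) ⇔ ((fun f (fin (suc m)) ≡ ω) × ∃ (λ k → fun r (fin k) ≡ fin m))
  r-ω≡fin⇔ {m} = mk⇔ attained bounded
    where
    attained : fun r ω ≡ fin m → (fun f (fin (suc m)) ≡ ω) × ∃ (λ k → fun r (fin k) ≡ fin m)
    attained e with fin≤r-ω⇒ (≤ω-reflexive (sym e))
    ... | k , m≤rk = to r-ω≤fin⇔ (≤ω-reflexive e)
                   , k , ≤ω-antisym (≤ω-trans (mono r ≤ω-top) (≤ω-reflexive e)) m≤rk

    bounded : (fun f (fin (suc m)) ≡ ω) × ∃ (λ k → fun r (fin k) ≡ fin m) → fun r ω ≡ fin m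
    bounded (f-sm≡ω , k , e) =
      ≤ω-antisym (from r-ω≤fin⇔ f-sm≡ω) (≤ω-trans (≤ω-reflexive (sym e)) (mono r ≤ω-top))

  r-ω≡ω⇔ : (fun r ω ≡ ω) ⇔ (fun f ω <ω ω ⊎ (fun f ω ≡ ω × ((k : ℕ) → fun f (fin k) <ω ω)))
  r-ω≡ω⇔ = ⇔-trans (⇔-trans ≡ω⇔unbounded unbounded⇔)
                   (⇔-trans (⇔-sym (all-fin<ω⇔all-suc≢ω f)) (all-fin<ω⇔ f))
    where
    unbounded⇔ : (∀ m → ¬ fun r ω ≤ω fin m) ⇔ (∀ m → fun f (fin (suc m)) ≢ ω)
    unbounded⇔ = mk⇔ (λ h m → to (¬-cong-⇔ r-ω≤fin⇔) (h m))
                     (λ h m → from (¬-cong-⇔ r-ω≤fin⇔) (h m))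

lemma2p6 : (f r : TimeWarp) → IsLeftResidual f idTW r →
    ((n : ℕ) → n ≢ 0 → (m : ℕ) →
    (fun r (fin n) ≡ fin m) ⇔ ((fun f (fin m) ≤ω fin n) × (fin n <ω fun f (fin (suc m)))))
    × ((n : ℕ) → n ≢ 0 →
    (fun r (fin n) ≡ ω) ⇔ (fun f ω ≤ω fin n))
    × ((m : ℕ) →
    (fun r ω ≡ fin m) ⇔ ((fun f (fin (suc m)) ≡ ω) × ∃ (λ k → fun r (fin k) ≡ fin m)))
    × ((fun r ω ≡ ω) ⇔ ((fun f ω <ω ω) ⊎ ((fun f ω ≡ ω) × ((k : ℕ) → fun f (fin k) <ω ω))))
lemma2p6 f r res =
    (λ _ n≢0 _ → r-fin≡fin⇔ n≢0)
  , (λ _ n≢0 → r-fin≡ω⇔ n≢0)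
  , (λ _ → r-ω≡fin⇔)
  , r-ω≡ω⇔
  where open Residual f r res
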